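{- For every positive integer $n$, the $n\times n$ rook graph $R_n$ is not (isomorphic to) the point graph of any strongly regular configuration.
   Context: The $n\times n$ rook graph $R_n$ has vertex set $\{(x,y): x,y\in\{1,\dots,n\}\}$, with distinct vertices $(x_1,y_1),(x_2,y_2)$ adjacent iff $x_1=x_2$ or $y_1=y_2$. A symmetric $(v_k)$ configuration is a finite incidence structure of $v$ points and $v$ lines such that every line has exactly $k$ points, every point lies on exactly $k$ lines, and two distinct points lie on at most one common line; throughout $k\ge 3$. Its point graph has the points as vertices, two distinct points adjacent iff they lie on a common line. A strongly regular configuration with parameters $(v_k;\lambda,\mu)$ is a symmetric $(v_k)$ configuration whose point graph is a strongly regular graph $SRG(v,k(k-1),\lambda,\mu)$. -}

module Defs where

open import Data.Nat using (ℕ; zero; suc; _+_)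
open import Data.Fin using (Fin; zero; suc)
open import Data.Fin.Properties using (any?)
open import Data.Product using (_×_; ∃; _,_)
open import Data.Sum using (_⊎_)
open import Data.Bool using (if_then_else_)
open import Relation.Nullary using (¬_; Dec; does; ¬?)
open import Relation.Nullary.Decidable using (_×-dec_)
open import Relation.Unary using (Decidable)
open import Relation.Binary.PropositionalEquality using (_≡_; _≢_)
open import Function.Bundles using (Bijection; _⤖_)

count : ∀ {m} {P : Fin m → Set} → Decidable P → ℕ
count {zero}  P? = 0
count {suc m} P? = (if does (P? zero) then 1 else 0) + count (λ i → P? (suc i))

record Configuration (v k : ℕ) : Set₁ where
  field
    I         : Fin v → Fin v → Set
    I?        : ∀ p l → Dec (I p l)
    lineSize  : ∀ (l : Fin v) → count (λ p → I? p l) ≡ k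
    pointDeg  : ∀ (p : Fin v) → count (λ l → I? p l) ≡ k
    linear    : ∀ p q l l′ → p ≢ q → I p l → I q l → I p l′ → I q l′ → l ≡ l′

module _ {v k : ℕ} (C : Configuration v k) where
  open Configuration C

  PointAdj : Fin v → Fin v → Set
  PointAdj p q = p ≢ q × ∃ λ l → I p l × I q l

  pointAdj? : ∀ p q → Dec (PointAdj p q)
  pointAdj? p q = ¬? (p Data.Fin.≟ q) ×-dec any? (λ l → I? p l ×-dec I? q l)

record IsSRG (v : ℕ) (Adj : Fin v → Fin v → Set) (Adj? : ∀ x y → Dec (Adj x y))
             (K lam mu : ℕ) : Set where
  field
    regular  : ∀ x → count (Adj? x) ≡ K
    adjCommon    : ∀ x y → Adj x y →
                   count (λ z → Adj? x z ×-dec Adj? y z) ≡ lam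
    nonAdjCommon : ∀ x y → x ≢ y → ¬ Adj x y →
                   count (λ z → Adj? x z ×-dec Adj? y z) ≡ mu

record StronglyRegularConfiguration (v k lam mu : ℕ) : Set₁ where
  field
    config : Configuration v k
    srg    : IsSRG v (PointAdj config) (pointAdj? config) (k Data.Nat.* (k Data.Nat.∸ 1)) lam mu

RookAdj : (n : ℕ) → Fin n × Fin n → Fin n × Fin n → Set
RookAdj n (x₁ , y₁) (x₂ , y₂) = (x₁ , y₁) ≢ (x₂ , y₂) × (x₁ ≡ x₂ ⊎ y₁ ≡ y₂)

record RookIso (n v : ℕ) (Adj : Fin v → Fin v → Set) : Set where
  field
    bij      : (Fin n × Fin n) ⤖ Fin v
    preserve : ∀ a b → RookAdj n a b → Adj (Bijection.to bij a) (Bijection.to bij b)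
    reflect  : ∀ a b → Adj (Bijection.to bij a) (Bijection.to bij b) → RookAdj n a b

-- Every line has k ≥ 3 points, all pairwise adjacent, so it lies in a row or a column of
-- the rook graph; as a point p lies on at least three lines, two of them, say, lie in
-- p's row. Take a point q ≠ p of the second one. Then q is joined to each of the k points
-- of the first line by k distinct lines, and the line joining q to a point of its own
-- column misses the first line: q lies on k + 1 lines.
module Submission where

open import Defs
open import Data.Nat using (ℕ; zero; suc; _≤_; z≤n; s≤s; s≤s⁻¹)
open import Data.Nat.Properties using (≤-antisym; ≤-trans; ≤-reflexive; m≤n⇒m≤1+n; n≤1+n; 1+n≰n; module ≤-Reasoning)
open import Data.Fin using (Fin; zero; suc)
open import Data.Fin.Properties using (_≟_; any?; suc-injective; 0≢1+n)
open import Data.Product using (_×_; ∃; ∃₂; _,_; proj₁; proj₂)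
open import Data.Sum using (_⊎_; inj₁; inj₂; swap)
open import Data.Empty using (⊥; ⊥-elim)
open import Function using (_∘_; _⇔_; mk⇔; Equivalence)
open import Function.Bundles using (Bijection; Surjection)
open import Relation.Nullary using (¬_; yes; no; ¬?)
open import Relation.Nullary.Decidable using (_×-dec_; _⊎-dec_)
open import Relation.Unary using (Decidable)
open import Relation.Binary.PropositionalEquality
  using (_≡_; _≢_; refl; sym; trans; cong; cong₂; subst; subst₂)

without : ∀ {m} {P : Fin m → Set} → Decidable P → (y : Fin m) → Decidable (λ x → P x × x ≢ y)
without P? y x = P? x ×-dec ¬? (x ≟ y)

count-mono : ∀ {m} {P Q : Fin m → Set} (P? : Decidable P) (Q? : Decidable Q) →
             (∀ x → P x → Q x) → count P? ≤ count Q?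
count-mono {zero}  P? Q? P⊆Q = z≤n
count-mono {suc m} P? Q? P⊆Q with P? zero | Q? zero
... | yes _  | yes _  = s≤s (count-mono (P? ∘ suc) (Q? ∘ suc) (P⊆Q ∘ suc))
... | yes p  | no ¬q  = ⊥-elim (¬q (P⊆Q zero p))
... | no _   | yes _  = m≤n⇒m≤1+n (count-mono (P? ∘ suc) (Q? ∘ suc) (P⊆Q ∘ suc))
... | no _   | no _   = count-mono (P? ∘ suc) (Q? ∘ suc) (P⊆Q ∘ suc)

count-cong : ∀ {m} {P Q : Fin m → Set} (P? : Decidable P) (Q? : Decidable Q) →
             (∀ x → P x ⇔ Q x) → count P? ≡ count Q?
count-cong P? Q? P⇔Q = ≤-antisym (count-mono P? Q? (Equivalence.to ∘ P⇔Q))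
                                 (count-mono Q? P? (Equivalence.from ∘ P⇔Q))

count-without : ∀ {m} {P : Fin (suc m) → Set} (P? : Decidable P) (y : Fin m) →
                count (without (P? ∘ suc) y) ≡ count (without P? (suc y) ∘ suc)
count-without P? y = count-cong (without (P? ∘ suc) y) (without P? (suc y) ∘ suc)
  (λ x → mk⇔ (λ (p , x≢y) → p , x≢y ∘ suc-injective) (λ (p , sx≢sy) → p , sx≢sy ∘ cong suc))

count-remove : ∀ {m} {P : Fin m → Set} (P? : Decidable P) {y : Fin m} → P y →
               count P? ≡ suc (count (without P? y))
count-remove {suc m} P? {zero} p0 with P? zero
... | no ¬p0 = ⊥-elim (¬p0 p0)
... | yes _  = cong suc (count-cong (P? ∘ suc) (without P? zero ∘ suc)
                          (λ x → mk⇔ (λ p → p , 0≢1+n ∘ sym) proj₁))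
count-remove {suc m} P? {suc y} py with P? zero
... | yes _ = cong suc (trans (count-remove (P? ∘ suc) py) (cong suc (count-without P? y)))
... | no _  = trans (count-remove (P? ∘ suc) py) (cong suc (count-without P? y))

1≤count⇒∃ : ∀ {m} {P : Fin m → Set} (P? : Decidable P) → 1 ≤ count P? → ∃ P
1≤count⇒∃ {suc m} P? 1≤count with P? zero
... | yes p = zero , p
... | no _  = let x , px = 1≤count⇒∃ (P? ∘ suc) 1≤count in suc x , px

count-without-≥ : ∀ {m} {P : Fin m → Set} (P? : Decidable P) {c : ℕ} {y : Fin m} →
                  P y → suc c ≤ count P? → c ≤ count (without P? y)
count-without-≥ P? py c<count = s≤s⁻¹ (subst (_ ≤_) (count-remove P? py) c<count)

∃-another : ∀ {m} {P : Fin m → Set} (P? : Decidable P) {y : Fin m} →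
          P y → 2 ≤ count P? → ∃ λ x → P x × x ≢ y
∃-another P? py 2≤count = 1≤count⇒∃ (without P? _) (count-without-≥ P? py 2≤count)

three-distinct : ∀ {m} {P : Fin m → Set} (P? : Decidable P) → 3 ≤ count P? →
                 ∃₂ λ x y → ∃ λ z → (P x × P y × P z) × x ≢ y × x ≢ z × y ≢ z
three-distinct P? 3≤count =
  let x , px           = 1≤count⇒∃ P? (≤-trans (s≤s z≤n) 3≤count)
      y , py , y≢x     = ∃-another P? px (≤-trans (s≤s (s≤s z≤n)) 3≤count)
      z , (pz , z≢x) , z≢y = ∃-another (without P? x) (py , y≢x) (count-without-≥ P? px 3≤count)
  in x , y , z , (px , py , pz) , y≢x ∘ sym , z≢x ∘ sym , z≢y ∘ sym

count-≤-injection : ∀ {m w} {P : Fin m → Set} {Q : Fin w → Set} (P? : Decidable P) (Q? : Decidable Q)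
  (h : ∀ x → P x → Fin w) → (∀ x px → Q (h x px)) →
  (∀ x y px py → h x px ≡ h y py → x ≡ y) → count P? ≤ count Q?
count-≤-injection {zero} P? Q? h h-into h-inj = z≤n
count-≤-injection {suc m} P? Q? h h-into h-inj with P? zero
... | no _ = count-≤-injection (P? ∘ suc) Q? (h ∘ suc) (h-into ∘ suc)
               (λ x y px py → suc-injective ∘ h-inj (suc x) (suc y) px py)
... | yes p0 = ≤-trans
   (s≤s (count-≤-injection (P? ∘ suc) (without Q? (h zero p0)) (h ∘ suc)
      (λ x px → h-into (suc x) px , 0≢1+n ∘ sym ∘ h-inj (suc x) zero px p0)
      (λ x y px py → suc-injective ∘ h-inj (suc x) (suc y) px py)))
   (≤-reflexive (sym (count-remove Q? (h-into zero p0))))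

distinct⇒∃≢ : ∀ {m} {a b : Fin m} → a ≢ b → ∀ c → ∃ λ d → d ≢ c
distinct⇒∃≢ {a = a} {b} a≢b c with a ≟ c
... | yes a≡c = b , λ b≡c → a≢b (trans a≡c (sym b≡c))
... | no a≢c  = a , a≢c

module _ {v k : ℕ} (C : Configuration v k) where
  open Configuration C

  line-has-another-point : 2 ≤ k → ∀ {p L} → I p L → ∃ λ x → I x L × x ≢ p
  line-has-another-point 2≤k {L = L} p∈L =
    ∃-another (λ x → I? x L) p∈L (subst (2 ≤_) (sym (lineSize L)) 2≤k)

  three-lines-through : 3 ≤ k → ∀ p → ∃₂ λ L₁ L₂ → ∃ λ L₃ →
                        (I p L₁ × I p L₂ × I p L₃) × L₁ ≢ L₂ × L₁ ≢ L₃ × L₂ ≢ L₃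
  three-lines-through 3≤k p = three-distinct (I? p) (subst (3 ≤_) (sym (pointDeg p)) 3≤k)

  -- Otherwise the k lines joining q to the points of L, together with N, are k + 1 distinct
  -- lines through q.
  joined-to-line⇒meets-every-line-through : ∀ {q L} → ¬ I q L → (∀ x → I x L → PointAdj C q x) →
                                            ∀ {N} → I q N → ∃ λ x → I x L × I x N
  joined-to-line⇒meets-every-line-through {q} {L} q∉L joined {N} q∈N
    with any? (λ x → I? x L ×-dec I? x N)
  ... | yes meet   = meet
  ... | no misses = ⊥-elim (1+n≰n (≤-trans k<lines (≤-reflexive (pointDeg q))))
    where
      join : ∀ x → I x L → Fin v
      join x x∈L = proj₁ (proj₂ (joined x x∈L))

      q∈join : ∀ x x∈L → I q (join x x∈L)
      q∈join x x∈L = proj₁ (proj₂ (proj₂ (joined x x∈L)))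

      x∈join : ∀ x x∈L → I x (join x x∈L)
      x∈join x x∈L = proj₂ (proj₂ (proj₂ (joined x x∈L)))

      OnLOrQ? : Decidable (λ x → I x L ⊎ x ≡ q)
      OnLOrQ? x = I? x L ⊎-dec (x ≟ q)

      line-to : ∀ x → I x L ⊎ x ≡ q → Fin v
      line-to x (inj₁ x∈L) = join x x∈L
      line-to x (inj₂ _)   = N

      q∈line-to : ∀ x x∈ → I q (line-to x x∈)
      q∈line-to x (inj₁ x∈L) = q∈join x x∈L
      q∈line-to x (inj₂ _)   = q∈N

      line-to-injective : ∀ x y x∈ y∈ → line-to x x∈ ≡ line-to y y∈ → x ≡ y
      line-to-injective x y (inj₁ x∈L) (inj₁ y∈L) eq with x ≟ y
      ... | yes x≡y = x≡y
      ... | no x≢y  = ⊥-elim (q∉L (subst (I q) join≡L (q∈join x x∈L)))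
        where join≡L = linear x y _ L x≢y (x∈join x x∈L)
                         (subst (I y) (sym eq) (x∈join y y∈L)) x∈L y∈L
      line-to-injective x _ (inj₁ x∈L) (inj₂ refl) eq =
        ⊥-elim (misses (x , x∈L , subst (I x) eq (x∈join x x∈L)))
      line-to-injective _ y (inj₂ refl) (inj₁ y∈L) eq =
        ⊥-elim (misses (y , y∈L , subst (I y) (sym eq) (x∈join y y∈L)))
      line-to-injective _ _ (inj₂ refl) (inj₂ refl) _ = refl

      k<lines : suc k ≤ count (I? q)
      k<lines = begin
        suc k                               ≡⟨ cong suc (sym (lineSize L)) ⟩
        suc (count (λ x → I? x L))          ≤⟨ s≤s (count-mono (λ x → I? x L) (without OnLOrQ? q)
                                                 (λ x x∈L → inj₁ x∈L , λ { refl → q∉L x∈L })) ⟩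
        suc (count (without OnLOrQ? q))     ≡⟨ sym (count-remove OnLOrQ? (inj₂ refl)) ⟩
        count OnLOrQ?                       ≤⟨ count-≤-injection OnLOrQ? (I? q) line-to q∈line-to
                                                 line-to-injective ⟩
        count (I? q)                        ∎
        where open ≤-Reasoning

record RookCoordinates {v k : ℕ} (C : Configuration v k) (n : ℕ) : Set where
  field
    row col               : Fin v → Fin n
    coordinates-injective : ∀ u w → row u ≡ row w → col u ≡ col w → u ≡ w
    adjacent⇒aligned      : ∀ u w → PointAdj C u w → row u ≡ row w ⊎ col u ≡ col w
    aligned⇒adjacent      : ∀ u w → u ≢ w → row u ≡ row w ⊎ col u ≡ col w → PointAdj C u w
    point-at              : ∀ a b → ∃ λ u → row u ≡ a × col u ≡ b

module _ {v k : ℕ} {C : Configuration v k} {n : ℕ} where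
  open Configuration C

  transpose : RookCoordinates C n → RookCoordinates C n
  transpose R = record
    { row                   = col
    ; col                   = row
    ; coordinates-injective = λ u w r c → coordinates-injective u w c r
    ; adjacent⇒aligned      = λ u w → swap ∘ adjacent⇒aligned u w
    ; aligned⇒adjacent      = λ u w u≢w → aligned⇒adjacent u w u≢w ∘ swap
    ; point-at              = λ a b → let u , r , c = point-at b a in u , c , r
    }
    where open RookCoordinates R

  module _ (R : RookCoordinates C n) where
    open RookCoordinates R

    RowLine : Fin v → Fin v → Set
    RowLine p L = I p L × ∃ λ x → I x L × x ≢ p × row x ≡ row p

    -- A point of L off p's row would be adjacent to p and to x, hence in the column of both.
    row-line⊆row : ∀ {p L} → RowLine p L → ∀ y → I y L → row y ≡ row p
    row-line⊆row {p} {L} (p∈L , x , x∈L , x≢p , rx≡rp) y y∈L with y ≟ p | y ≟ x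
    ... | yes refl | _        = refl
    ... | no _     | yes refl = rx≡rp
    ... | no y≢p   | no y≢x
      with adjacent⇒aligned p y ((y≢p ∘ sym) , L , p∈L , y∈L)
         | adjacent⇒aligned x y ((y≢x ∘ sym) , L , x∈L , y∈L)
    ... | inj₁ rp≡ry | _          = sym rp≡ry
    ... | inj₂ _     | inj₁ rx≡ry = trans (sym rx≡ry) rx≡rp
    ... | inj₂ cp≡cy | inj₂ cx≡cy =
      ⊥-elim (x≢p (coordinates-injective x p rx≡rp (trans cx≡cy (sym cp≡cy))))

  ColumnLine : RookCoordinates C n → Fin v → Fin v → Set
  ColumnLine R = RowLine (transpose R)

  line-along-row-or-column : (R : RookCoordinates C n) → 2 ≤ k →
                             ∀ {p L} → I p L → RowLine R p L ⊎ ColumnLine R p L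
  line-along-row-or-column R 2≤k {p} {L} p∈L with line-has-another-point C 2≤k p∈L
  ... | x , x∈L , x≢p with RookCoordinates.adjacent⇒aligned R x p (x≢p , L , x∈L , p∈L)
  ... | inj₁ rx≡rp = inj₁ (p∈L , x , x∈L , x≢p , rx≡rp)
  ... | inj₂ cx≡cp = inj₂ (p∈L , x , x∈L , x≢p , cx≡cp)

  -- As x ≠ p share a row, n ≥ 2 and q's column has a point w off q's row. The line through
  -- q and w is a column line, so it misses L₁ ⊆ row q, although q is joined to all of L₁.
  two-row-lines-absurd : (R : RookCoordinates C n) → ∀ {p L₁ L₂} → L₁ ≢ L₂ →
                         RowLine R p L₁ → RowLine R p L₂ → ⊥
  two-row-lines-absurd R {p} {L₁} {L₂} L₁≢L₂
    row₁@(p∈L₁ , x , _ , x≢p , rx≡rp) (p∈L₂ , q , q∈L₂ , q≢p , rq≡rp) =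
    let a , a≢rq            = distinct⇒∃≢ (x≢p ∘ coordinates-injective x p rx≡rp) (row q)
        w , rw≡a , cw≡cq    = point-at a (col q)
        w≢q : w ≢ q
        w≢q w≡q             = a≢rq (trans (sym rw≡a) (cong row w≡q))
        _ , N , q∈N , w∈N   = aligned⇒adjacent q w (w≢q ∘ sym) (inj₂ (sym cw≡cq))
        y , y∈L₁ , y∈N      = joined-to-line⇒meets-every-line-through C q∉L₁ joined q∈N
        cy≡cq               = row-line⊆row (transpose R) (q∈N , w , w∈N , w≢q , cw≡cq) y y∈N
    in q∉L₁ (subst (λ z → I z L₁) (coordinates-injective y q (in-row-of-q y y∈L₁) cy≡cq) y∈L₁)
    where
      open RookCoordinates R

      q∉L₁ : ¬ I q L₁
      q∉L₁ q∈L₁ = L₁≢L₂ (sym (linear p q L₂ L₁ (q≢p ∘ sym) p∈L₂ q∈L₂ p∈L₁ q∈L₁))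

      in-row-of-q : ∀ y → I y L₁ → row y ≡ row q
      in-row-of-q y y∈L₁ = trans (row-line⊆row R row₁ y y∈L₁) (sym rq≡rp)

      joined : ∀ y → I y L₁ → PointAdj C q y
      joined y y∈L₁ = aligned⇒adjacent q y (λ { refl → q∉L₁ y∈L₁ }) (inj₁ (sym (in-row-of-q y y∈L₁)))

  module _ (R : RookCoordinates C n) (3≤k : 3 ≤ k) where
    private
      along : ∀ {p L} → I p L → RowLine R p L ⊎ ColumnLine R p L
      along = line-along-row-or-column R (≤-trans (n≤1+n 2) 3≤k)

    rook-coordinates-impossible : Fin v → ⊥
    rook-coordinates-impossible p with three-lines-through C 3≤k p
    ... | L₁ , L₂ , L₃ , (p∈L₁ , p∈L₂ , p∈L₃) , L₁≢L₂ , L₁≢L₃ , L₂≢L₃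
      with along p∈L₁ | along p∈L₂ | along p∈L₃
    ... | inj₁ r₁ | inj₁ r₂ | _       = two-row-lines-absurd R L₁≢L₂ r₁ r₂
    ... | inj₂ c₁ | inj₂ c₂ | _       = two-row-lines-absurd (transpose R) L₁≢L₂ c₁ c₂
    ... | inj₁ r₁ | _       | inj₁ r₃ = two-row-lines-absurd R L₁≢L₃ r₁ r₃
    ... | inj₂ c₁ | _       | inj₂ c₃ = two-row-lines-absurd (transpose R) L₁≢L₃ c₁ c₃
    ... | _       | inj₁ r₂ | inj₁ r₃ = two-row-lines-absurd R L₂≢L₃ r₂ r₃
    ... | _       | inj₂ c₂ | inj₂ c₃ = two-row-lines-absurd (transpose R) L₂≢L₃ c₂ c₃

rookIso⇒coordinates : ∀ {n v k} (C : Configuration v k) → RookIso n v (PointAdj C) → RookCoordinates C n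
rookIso⇒coordinates {n} {v} C iso = record
  { row                   = proj₁ ∘ from
  ; col                   = proj₂ ∘ from
  ; coordinates-injective = λ u w r c → from-injective (cong₂ _,_ r c)
  ; adjacent⇒aligned      = λ u w → proj₂ ∘ reflect (from u) (from w) ∘ transport-adj u w
  ; aligned⇒adjacent      = λ u w u≢w aligned →
      subst₂ (PointAdj C) (to∘from u) (to∘from w)
        (preserve (from u) (from w) (u≢w ∘ from-injective , aligned))
  ; point-at              = λ a b → to (a , b) , cong proj₁ (from∘to (a , b)) , cong proj₂ (from∘to (a , b))
  }
  where
    open RookIso iso
    open Bijection bij using (to; injective)

    from : Fin v → Fin n × Fin n
    from = Bijection.to⁻ bij

    to∘from : ∀ u → to (from u) ≡ u
    to∘from = Surjection.to∘to⁻ (Bijection.surjection bij)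

    from-injective : ∀ {u w} → from u ≡ from w → u ≡ w
    from-injective {u} {w} eq = trans (sym (to∘from u)) (trans (cong to eq) (to∘from w))

    from∘to : ∀ a → from (to a) ≡ a
    from∘to a = injective (to∘from (to a))

    transport-adj : ∀ u w → PointAdj C u w → PointAdj C (to (from u)) (to (from w))
    transport-adj u w = subst₂ (PointAdj C) (sym (to∘from u)) (sym (to∘from w))

theorem19 : ∀ (n : ℕ) → 1 ≤ n →
    ∀ (v k lam mu : ℕ) → 3 ≤ k →
    (S : StronglyRegularConfiguration v k lam mu) →
    ¬ RookIso n v (PointAdj (StronglyRegularConfiguration.config S))
theorem19 (suc n) _ _ _ _ _ 3≤k S iso =
  rook-coordinates-impossible (rookIso⇒coordinates (StronglyRegularConfiguration.config S) iso) 3≤k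
    (Bijection.to (RookIso.bij iso) (zero , zero))
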